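{- Let $n\ge 3$ and let $G$ be the path $P_n$ or the cycle $C_n$. Then $$\gamma_{LTD}(M(G))\ge \left\lfloor\frac n2\right\rfloor-\left\lfloor\frac n4\right\rfloor+\left\lceil\frac n4\right\rceil+1.$$
   Context: All graphs are finite, simple and connected. For a graph $G=(V,E)$ and $x\in V$, $N(x)$ is the open neighbourhood. A set $C\subseteq V$ is a locating total-dominating set ($LTD$-set) if $N(x)\cap C\neq\emptyset$ for all $x\in V$ and $N(x)\cap C\neq N(y)\cap C$ for all distinct $x,y\in V\setminus C$; $\gamma_{LTD}(G)$ is the minimum size of an $LTD$-set. $P_n$ is the path and $C_n$ the cycle on $n$ vertices. The Mycielski graph $M(G)$ of $G$ with $V=\{v_1,\dots,v_n\}$ is obtained from $G$ by adding, for each $i$, a new vertex $u_i$ adjacent to every vertex of $N_G(v_i)$, and then adding one further vertex $u$ adjacent to all of $u_1,\dots,u_n$ (and to nothing else). -}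

module Defs where

open import Data.Nat using (ℕ; zero; suc; _+_)
open import Data.Fin using (Fin; zero; suc; toℕ; splitAt)
open import Data.Fin.Subset using (Subset; _∈_; _∉_)
open import Data.Sum using (_⊎_; inj₁; inj₂)
open import Data.Product using (Σ; _×_; ∃-syntax)
open import Data.Empty using (⊥)
open import Data.Unit using (⊤)
open import Relation.Binary.PropositionalEquality using (_≡_; _≢_)
open import Relation.Nullary using (¬_)
open import Function.Bundles using (_⇔_)

Graph : ℕ → Set₁
Graph m = Fin m → Fin m → Set

Path : (n : ℕ) → Graph n
Path n i j = (toℕ j ≡ suc (toℕ i)) ⊎ (toℕ i ≡ suc (toℕ j))

Cycle : (n : ℕ) → Graph n
Cycle n i j = Path n i j
  ⊎ ((toℕ i ≡ 0 × suc (toℕ j) ≡ n) ⊎ (toℕ j ≡ 0 × suc (toℕ i) ≡ n))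

-- Mycielski graph on Fin (suc (n + n)):
--   zero            = the extra vertex u,
--   suc k, k = inj₁ i under splitAt n  = v_i  (copy of G),
--   suc k, k = inj₂ i under splitAt n  = u_i  (shadow vertex).
data MVert (n : ℕ) : Set where
  vU : MVert n
  vV : Fin n → MVert n
  vS : Fin n → MVert n

classify : {n : ℕ} → Fin (suc (n + n)) → MVert n
classify zero = vU
classify {n} (suc k) with splitAt n k
... | inj₁ i = vV i
... | inj₂ i = vS i

MAdj : {n : ℕ} → Graph n → MVert n → MVert n → Set
MAdj G (vV i) (vV j) = G i j
MAdj G (vV i) (vS j) = G i j
MAdj G (vS i) (vV j) = G j i
MAdj G (vS i) vU     = ⊤
MAdj G vU     (vS j) = ⊤
MAdj G _      _      = ⊥

Mycielski : {n : ℕ} → Graph n → Graph (suc (n + n))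
Mycielski G x y = MAdj G (classify x) (classify y)

IsLTD : {m : ℕ} → Graph m → Subset m → Set
IsLTD {m} G C =
  (∀ (x : Fin m) → ∃[ y ] (G x y × y ∈ C))
  × (∀ (x y : Fin m) → x ≢ y → x ∉ C → y ∉ C →
       ¬ (∀ (z : Fin m) → z ∈ C → (G x z ⇔ G y z)))

{-# OPTIONS --safe #-}
-- Weigh each vertex i of the cycle by the
-- number of its copies v_i, u_i lying in C.  Every v_i has a neighbour in C among the v_j, u_j
-- with j adjacent to i, so these weights totally dominate C_n, and any weighting that totally
-- dominates C_n has total weight at least γt(C_n) = ⌊n/2⌋ − ⌊n/4⌋ + ⌈n/4⌉: summing the
-- covering conditions around the cycle shows that twice the weight is at least n, and for even
-- n this applies to the even and to the odd positions separately.  If u ∈ C this gives the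
-- extra 1.  Otherwise each u_i is dominated by some v_j, so the v-weights alone totally
-- dominate C_n, while u forces some u_j into C.
module Submission where

open import Defs
open import Data.Nat using (ℕ; zero; suc; _+_; _∸_; _≤_; _<_; z≤n; s≤s; s≤s⁻¹; pred; NonZero; >-nonZero; ⌈_/2⌉)
open import Data.Nat.DivMod using (_/_; _%_; +-distrib-/-∣ˡ; /-monoʳ-≤; %-distribˡ-+; m%n%n≡m%n; [m+n]%n≡m%n; m<n⇒m%n≡m; m%n<n; n%n≡0)
open import Data.Nat.Divisibility using (divides)
open import Data.Nat.Properties
open import Data.Nat.Tactic.RingSolver using (solve-∀)
open import Algebra.Properties.CommutativeSemigroup +-commutativeSemigroup using (interchange)
open import Data.Bool using (true; false; if_then_else_)
open import Data.Vec using ([]; _∷_; here; there)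
open import Data.Fin using (Fin; zero; suc; toℕ; fromℕ<; splitAt; _↑ˡ_; _↑ʳ_)
open import Data.Fin.Properties using (toℕ<n; toℕ-fromℕ<; toℕ-↑ˡ; toℕ-↑ʳ; splitAt-↑ˡ; splitAt-↑ʳ; splitAt⁻¹-↑ˡ; splitAt⁻¹-↑ʳ)
open import Data.Fin.Subset using (Subset; _∈_; ∣_∣)
open import Data.Product using (_×_; _,_; ∃-syntax)
open import Data.Sum using (_⊎_; inj₁; inj₂)
open import Function using (id; _∘_)
open import Relation.Nullary using (contradiction)
open import Relation.Binary.PropositionalEquality

∑< : ℕ → (ℕ → ℕ) → ℕ
∑< zero    f = 0
∑< (suc m) f = ∑< m f + f m

syntax ∑< m (λ k → e) = ∑[ k < m ] e

∑-cong : ∀ m {f g : ℕ → ℕ} → (∀ {k} → k < m → f k ≡ g k) → ∑< m f ≡ ∑< m g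
∑-cong zero    f≗g = refl
∑-cong (suc m) f≗g = cong₂ _+_ (∑-cong m (λ k<m → f≗g (m<n⇒m<1+n k<m))) (f≗g ≤-refl)

∑-mono-≤ : ∀ m {f g : ℕ → ℕ} → (∀ k → f k ≤ g k) → ∑< m f ≤ ∑< m g
∑-mono-≤ zero    f≤g = z≤n
∑-mono-≤ (suc m) f≤g = +-mono-≤ (∑-mono-≤ m f≤g) (f≤g m)

∑-one : ∀ m → ∑[ k < m ] 1 ≡ m
∑-one zero    = refl
∑-one (suc m) = trans (cong (_+ 1) (∑-one m)) (+-comm m 1)

∑-distrib-+ : ∀ m {f g : ℕ → ℕ} → ∑[ k < m ] (f k + g k) ≡ ∑< m f + ∑< m g
∑-distrib-+ zero    = refl
∑-distrib-+ (suc m) {f} {g} = begin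
  ∑[ k < m ] (f k + g k) + (f m + g m) ≡⟨ cong (_+ (f m + g m)) (∑-distrib-+ m) ⟩
  ∑< m f + ∑< m g + (f m + g m)       ≡⟨ interchange (∑< m f) (∑< m g) (f m) (g m) ⟩
  ∑< m f + f m + (∑< m g + g m)       ∎
  where open ≡-Reasoning

∑-split : ∀ a b {f : ℕ → ℕ} → ∑< (a + b) f ≡ ∑< a f + ∑[ k < b ] f (a + k)
∑-split a zero    {f} = trans (cong (λ c → ∑< c f) (+-identityʳ a)) (sym (+-identityʳ _))
∑-split a (suc b) {f} = begin
  ∑< (a + suc b) f                          ≡⟨ cong (λ c → ∑< c f) (+-suc a b) ⟩
  ∑< (a + b) f + f (a + b)                  ≡⟨ cong (_+ f (a + b)) (∑-split a b) ⟩
  ∑< a f + ∑[ k < b ] f (a + k) + f (a + b) ≡⟨ +-assoc (∑< a f) _ _ ⟩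
  ∑< a f + ∑[ k < suc b ] f (a + k)         ∎
  where open ≡-Reasoning

∑-term-≤ : ∀ {m k} (f : ℕ → ℕ) → k < m → f k ≤ ∑< m f
∑-term-≤ {suc m} {k} f k<1+m with m≤n⇒m<n∨m≡n (s≤s⁻¹ k<1+m)
... | inj₁ k<m  = ≤-trans (∑-term-≤ f k<m) (m≤m+n _ _)
... | inj₂ refl = m≤n+m _ _

∑-interleave : ∀ m {f : ℕ → ℕ} → ∑< (m + m) f ≡ ∑[ j < m ] f (j + j) + ∑[ j < m ] f (suc (j + j))
∑-interleave zero    = refl
∑-interleave (suc m) {f} = begin
  ∑< (suc m + suc m) f                         ≡⟨ cong (λ c → ∑< (suc c) f) (+-suc m m) ⟩
  ∑< (m + m) f + f (m + m) + f (suc (m + m))   ≡⟨ cong (λ s → s + f (m + m) + f (suc (m + m))) (∑-interleave m) ⟩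
  E + O + f (m + m) + f (suc (m + m))          ≡⟨ +-assoc (E + O) _ _ ⟩
  E + O + (f (m + m) + f (suc (m + m)))        ≡⟨ interchange E O _ _ ⟩
  E + f (m + m) + (O + f (suc (m + m)))        ∎
  where
  open ≡-Reasoning
  E O : ℕ
  E = ∑[ j < m ] f (j + j)
  O = ∑[ j < m ] f (suc (j + j))

Periodic : ℕ → (ℕ → ℕ) → Set
Periodic m f = ∀ k → f (k + m) ≡ f k

∑-rotate₁ : ∀ m {f : ℕ → ℕ} → f m ≡ f 0 → ∑[ k < m ] f (suc k) ≡ ∑< m f
∑-rotate₁ m {f} fm≡f0 = +-cancelˡ-≡ (f 0) _ _ (begin
  f 0 + ∑[ k < m ] f (suc k) ≡⟨ ∑-split 1 m ⟨
  ∑< m f + f m               ≡⟨ cong (∑< m f +_) fm≡f0 ⟩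
  ∑< m f + f 0               ≡⟨ +-comm (∑< m f) (f 0) ⟩
  f 0 + ∑< m f               ∎)
  where open ≡-Reasoning

∑-rotate : ∀ {m} {f : ℕ → ℕ} t → Periodic m f → ∑[ k < m ] f (t + k) ≡ ∑< m f
∑-rotate zero    per = refl
∑-rotate {m} {f} (suc t) per = begin
  ∑[ k < m ] f (suc (t + k)) ≡⟨ ∑-cong m (λ {k} _ → cong f (+-suc t k)) ⟨
  ∑[ k < m ] f (t + suc k)   ≡⟨ ∑-rotate₁ m (trans (per t) (cong f (sym (+-identityʳ t)))) ⟩
  ∑[ k < m ] f (t + k)       ≡⟨ ∑-rotate t per ⟩
  ∑< m f                     ∎
  where open ≡-Reasoning

periodic-average : ∀ {m} {f : ℕ → ℕ} t → Periodic m f → (∀ k → 1 ≤ f k + f (t + k)) →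
                   m ≤ ∑< m f + ∑< m f
periodic-average {m} {f} t per cover = begin
  m                              ≡⟨ ∑-one m ⟨
  ∑[ k < m ] 1                   ≤⟨ ∑-mono-≤ m cover ⟩
  ∑[ k < m ] (f k + f (t + k))   ≡⟨ ∑-distrib-+ m ⟩
  ∑< m f + ∑[ k < m ] f (t + k)  ≡⟨ cong (∑< m f +_) (∑-rotate t per) ⟩
  ∑< m f + ∑< m f                ∎
  where open ≤-Reasoning

γt : ℕ → ℕ
γt n = n / 2 ∸ n / 4 + (n + 3) / 4

γt-+4 : ∀ n → γt (4 + n) ≡ 2 + γt n
γt-+4 n = begin
  (4 + n) / 2 ∸ (4 + n) / 4 + (4 + (n + 3)) / 4
    ≡⟨ cong₂ _+_ (cong₂ _∸_ (+-distrib-/-∣ˡ {4} n {2} (divides 2 refl))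
                            (+-distrib-/-∣ˡ {4} n {4} (divides 1 refl)))
                 (+-distrib-/-∣ˡ {4} (n + 3) {4} (divides 1 refl)) ⟩
  (2 + n / 2) ∸ (1 + n / 4) + (1 + (n + 3) / 4)
    ≡⟨ cong (_+ (1 + (n + 3) / 4)) (+-∸-assoc 1 (/-monoʳ-≤ n {4} {2} (s≤s (s≤s z≤n)))) ⟩
  1 + (n / 2 ∸ n / 4) + (1 + (n + 3) / 4)
    ≡⟨ cong suc (+-suc _ _) ⟩
  2 + γt n ∎
  where open ≡-Reasoning

[2+m]+[2+m]≡4+[m+m] : ∀ m → (2 + m) + (2 + m) ≡ 4 + (m + m)
[2+m]+[2+m]≡4+[m+m] = solve-∀

γt-odd : ∀ m → γt (suc (m + m)) ≡ suc m
γt-odd zero          = refl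
γt-odd (suc zero)    = refl
γt-odd (suc (suc m)) = begin
  γt (suc ((2 + m) + (2 + m))) ≡⟨ cong (γt ∘ suc) ([2+m]+[2+m]≡4+[m+m] m) ⟩
  γt (4 + suc (m + m))         ≡⟨ γt-+4 (suc (m + m)) ⟩
  2 + γt (suc (m + m))         ≡⟨ cong (2 +_) (γt-odd m) ⟩
  2 + suc m                    ∎
  where open ≡-Reasoning

γt-even : ∀ m → γt (m + m) ≡ ⌈ m /2⌉ + ⌈ m /2⌉
γt-even zero          = refl
γt-even (suc zero)    = refl
γt-even (suc (suc m)) = begin
  γt ((2 + m) + (2 + m))        ≡⟨ cong γt ([2+m]+[2+m]≡4+[m+m] m) ⟩
  γt (4 + (m + m))              ≡⟨ γt-+4 (m + m) ⟩
  2 + γt (m + m)                ≡⟨ cong (2 +_) (γt-even m) ⟩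
  2 + (⌈ m /2⌉ + ⌈ m /2⌉)       ≡⟨ cong suc (+-suc _ _) ⟨
  suc ⌈ m /2⌉ + suc ⌈ m /2⌉     ∎
  where open ≡-Reasoning

m≤n+n⇒⌈m/2⌉≤n : ∀ {m n} → m ≤ n + n → ⌈ m /2⌉ ≤ n
m≤n+n⇒⌈m/2⌉≤n {n = n} m≤2n = ≤-trans (⌈n/2⌉-mono m≤2n) (≤-reflexive (sym (n≡⌈n+n/2⌉ n)))

even⊎odd : ∀ n → ∃[ m ] (n ≡ m + m ⊎ n ≡ suc (m + m))
even⊎odd zero = 0 , inj₁ refl
even⊎odd (suc n) with even⊎odd n
... | m , inj₁ refl = m , inj₂ refl
... | m , inj₂ refl = suc m , inj₁ (cong suc (sym (+-suc m m)))

periodic-cover-bound : ∀ n {f : ℕ → ℕ} → Periodic n f → (∀ k → 1 ≤ f k + f (2 + k)) → γt n ≤ ∑< n f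
periodic-cover-bound n {f} per cover with even⊎odd n
... | m , inj₂ refl = begin
  γt (suc (m + m))     ≡⟨ γt-odd m ⟩
  suc m                ≡⟨ cong suc (n≡⌊n+n/2⌋ m) ⟩
  ⌈ suc (m + m) /2⌉    ≤⟨ m≤n+n⇒⌈m/2⌉≤n (periodic-average 2 per cover) ⟩
  ∑< (suc (m + m)) f   ∎
  where open ≤-Reasoning
-- For even n the covering condition never leaves a parity class, and each class is a cycle of length m.
... | m , inj₁ refl = begin
  γt (m + m)                            ≡⟨ γt-even m ⟩
  ⌈ m /2⌉ + ⌈ m /2⌉                     ≤⟨ +-mono-≤ (residue-bound 0) (residue-bound 1) ⟩
  ∑< m (residue 0) + ∑< m (residue 1)   ≡⟨ ∑-interleave m ⟨
  ∑< (m + m) f                          ∎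
  where
  open ≤-Reasoning
  residue : ℕ → ℕ → ℕ
  residue r j = f (r + (j + j))
  residue-periodic : ∀ r → Periodic m (residue r)
  residue-periodic r j = trans (cong f (shift r j m)) (per (r + (j + j)))
    where
    shift : ∀ r j m → r + ((j + m) + (j + m)) ≡ r + (j + j) + (m + m)
    shift = solve-∀
  residue-cover : ∀ r j → 1 ≤ residue r j + residue r (1 + j)
  residue-cover r j = subst (λ x → 1 ≤ residue r j + f x) (step r j) (cover (r + (j + j)))
    where
    step : ∀ r j → 2 + (r + (j + j)) ≡ r + (suc j + suc j)
    step = solve-∀
  residue-bound : ∀ r → ⌈ m /2⌉ ≤ ∑< m (residue r)
  residue-bound r = m≤n+n⇒⌈m/2⌉≤n (periodic-average 1 (residue-periodic r) (residue-cover r))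

module _ {n : ℕ} .{{_ : NonZero n}} where

  %-absorbʳ : ∀ k m → (k + m % n) % n ≡ (k + m) % n
  %-absorbʳ k m = begin
    (k + m % n) % n          ≡⟨ %-distribˡ-+ k (m % n) n ⟩
    (k % n + m % n % n) % n  ≡⟨ cong (λ x → (k % n + x) % n) (m%n%n≡m%n m n) ⟩
    (k % n + m % n) % n      ≡⟨ %-distribˡ-+ k m n ⟨
    (k + m) % n              ∎
    where open ≡-Reasoning

  %-suc-injective : ∀ a b → suc a % n ≡ suc b % n → a % n ≡ b % n
  %-suc-injective a b eq = begin
    a % n                     ≡⟨ back a ⟩
    (pred n + suc a % n) % n  ≡⟨ cong (λ x → (pred n + x) % n) eq ⟩
    (pred n + suc b % n) % n  ≡⟨ back b ⟨
    b % n                     ∎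
    where
    open ≡-Reasoning
    back : ∀ c → c % n ≡ (pred n + suc c % n) % n
    back c = begin
      c % n                     ≡⟨ [m+n]%n≡m%n c n ⟨
      (c + n) % n               ≡⟨ cong (λ x → (c + x) % n) (suc-pred n) ⟨
      (c + suc (pred n)) % n    ≡⟨ cong (_% n) (swap c (pred n)) ⟩
      (pred n + suc c) % n      ≡⟨ %-absorbʳ (pred n) (suc c) ⟨
      (pred n + suc c % n) % n  ∎
      where
      swap : ∀ c p → c + suc p ≡ p + suc c
      swap = solve-∀

  successor-% : ∀ {a b : Fin n} → toℕ b ≡ suc (toℕ a) → suc (toℕ a) % n ≡ toℕ b
  successor-% {a} {b} b≡1+a = trans (m<n⇒m%n≡m (subst (_< n) b≡1+a (toℕ<n b))) (sym b≡1+a)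

  wraparound-% : ∀ {a b : Fin n} → toℕ b ≡ 0 → suc (toℕ a) ≡ n → suc (toℕ a) % n ≡ toℕ b
  wraparound-% b≡0 1+a≡n = trans (cong (_% n) 1+a≡n) (trans (n%n≡0 n) (sym b≡0))

  Cycle⇒suc-% : ∀ {i j : Fin n} → Cycle n i j → suc (toℕ i) % n ≡ toℕ j ⊎ suc (toℕ j) % n ≡ toℕ i
  Cycle⇒suc-% (inj₁ (inj₁ j≡1+i))         = inj₁ (successor-% j≡1+i)
  Cycle⇒suc-% (inj₁ (inj₂ i≡1+j))         = inj₂ (successor-% i≡1+j)
  Cycle⇒suc-% (inj₂ (inj₁ (i≡0 , 1+j≡n))) = inj₂ (wraparound-% i≡0 1+j≡n)
  Cycle⇒suc-% (inj₂ (inj₂ (j≡0 , 1+i≡n))) = inj₁ (wraparound-% j≡0 1+i≡n)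

  CycleCover : (ℕ → ℕ) → Set
  CycleCover w = ∀ (i : Fin n) → ∃[ j ] (Cycle n i j × 1 ≤ w (toℕ j))

  cycle-cover⇒periodic-cover : ∀ w → CycleCover w → ∀ k → 1 ≤ w (k % n) + w ((2 + k) % n)
  cycle-cover⇒periodic-cover w cover k with cover (fromℕ< (m%n<n (suc k) n))
  ... | j , i~j , 1≤wj with Cycle⇒suc-% i~j
  ... | inj₁ 1+i≡j = ≤-trans (subst (λ x → 1 ≤ w x) j≡[2+k] 1≤wj) (m≤n+m _ _)
    where
    j≡[2+k] : toℕ j ≡ (2 + k) % n
    j≡[2+k] = begin
      toℕ j                                    ≡⟨ 1+i≡j ⟨
      suc (toℕ (fromℕ< (m%n<n (suc k) n))) % n ≡⟨ cong (λ x → suc x % n) (toℕ-fromℕ< (m%n<n (suc k) n)) ⟩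
      (1 + suc k % n) % n                      ≡⟨ %-absorbʳ 1 (suc k) ⟩
      (2 + k) % n                              ∎
      where open ≡-Reasoning
  ... | inj₂ 1+j≡i = ≤-trans (subst (λ x → 1 ≤ w x) j≡k 1≤wj) (m≤m+n _ _)
    where
    j≡k : toℕ j ≡ k % n
    j≡k = begin
      toℕ j       ≡⟨ m<n⇒m%n≡m (toℕ<n j) ⟨
      toℕ j % n   ≡⟨ %-suc-injective (toℕ j) k (trans 1+j≡i (toℕ-fromℕ< (m%n<n (suc k) n))) ⟩
      k % n       ∎
      where open ≡-Reasoning

  cycle-cover-bound : ∀ w → CycleCover w → γt n ≤ ∑< n w
  cycle-cover-bound w cover = begin
    γt n                  ≤⟨ periodic-cover-bound n (λ k → cong w ([m+n]%n≡m%n k n))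
                                                    (cycle-cover⇒periodic-cover w cover) ⟩
    ∑[ k < n ] w (k % n)  ≡⟨ ∑-cong n (λ k<n → cong w (m<n⇒m%n≡m k<n)) ⟩
    ∑< n w                ∎
    where open ≤-Reasoning

Cycle-sym : ∀ {n} {i j : Fin n} → Cycle n i j → Cycle n j i
Cycle-sym (inj₁ (inj₁ e)) = inj₁ (inj₂ e)
Cycle-sym (inj₁ (inj₂ e)) = inj₁ (inj₁ e)
Cycle-sym (inj₂ (inj₁ e)) = inj₂ (inj₂ e)
Cycle-sym (inj₂ (inj₂ e)) = inj₂ (inj₁ e)

indicator : ∀ {m} → Subset m → ℕ → ℕ
indicator []       k       = 0
indicator (x ∷ xs) zero    = if x then 1 else 0
indicator (x ∷ xs) (suc k) = indicator xs k

∣∣≡∑-indicator : ∀ {m} (C : Subset m) → ∣ C ∣ ≡ ∑< m (indicator C)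
∣∣≡∑-indicator [] = refl
∣∣≡∑-indicator {suc m} C@(true ∷ xs) =
  trans (cong suc (∣∣≡∑-indicator xs)) (sym (∑-split 1 m {indicator C}))
∣∣≡∑-indicator {suc m} C@(false ∷ xs) =
  trans (∣∣≡∑-indicator xs) (sym (∑-split 1 m {indicator C}))

∈⇒1≤indicator : ∀ {m} {C : Subset m} {y : Fin m} → y ∈ C → 1 ≤ indicator C (toℕ y)
∈⇒1≤indicator here      = ≤-refl
∈⇒1≤indicator (there p) = ∈⇒1≤indicator p

module _ {n : ℕ} where

  position : MVert n → ℕ
  position vU     = 0
  position (vV i) = suc (toℕ i)
  position (vS i) = suc (n + toℕ i)

  position-classify : ∀ y → position (classify y) ≡ toℕ y
  position-classify zero = refl
  position-classify (suc k) with splitAt n k in eq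
  ... | inj₁ i = cong suc (trans (sym (toℕ-↑ˡ i n)) (cong toℕ (splitAt⁻¹-↑ˡ eq)))
  ... | inj₂ i = cong suc (trans (sym (toℕ-↑ʳ n i)) (cong toℕ (splitAt⁻¹-↑ʳ eq)))

  embed : MVert n → Fin (suc (n + n))
  embed vU     = zero
  embed (vV i) = suc (i ↑ˡ n)
  embed (vS i) = suc (n ↑ʳ i)

  classify-embed : ∀ x → classify (embed x) ≡ x
  classify-embed vU = refl
  classify-embed (vV i) rewrite splitAt-↑ˡ n i n = refl
  classify-embed (vS i) rewrite splitAt-↑ʳ n n i = refl

module _ {n : ℕ} (G : Graph n) (C : Subset (suc (n + n))) where

  weight : MVert n → ℕ
  weight x = indicator C (position x)

  MycielskiCover : Set
  MycielskiCover = ∀ x → ∃[ x′ ] (MAdj G x x′ × 1 ≤ weight x′)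

  total-domination⇒cover : (∀ y → ∃[ z ] (Mycielski G y z × z ∈ C)) → MycielskiCover
  total-domination⇒cover dom x with dom (embed x)
  ... | z , x~z , z∈C =
    classify z ,
    subst (λ x′ → MAdj G x′ (classify z)) (classify-embed x) x~z ,
    subst (λ p → 1 ≤ indicator C p) (sym (position-classify z)) (∈⇒1≤indicator z∈C)

  copyWeight shadowWeight : ℕ → ℕ
  copyWeight   k = indicator C (suc k)
  shadowWeight k = indicator C (suc (n + k))

  ∣∣≡apex+copies+shadows : ∣ C ∣ ≡ weight vU + (∑< n copyWeight + ∑< n shadowWeight)
  ∣∣≡apex+copies+shadows = begin
    ∣ C ∣                                             ≡⟨ ∣∣≡∑-indicator C ⟩
    ∑< (suc (n + n)) (indicator C)                    ≡⟨ ∑-split 1 (n + n) ⟩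
    weight vU + ∑< (n + n) copyWeight                 ≡⟨ cong (weight vU +_) (∑-split n n) ⟩
    weight vU + (∑< n copyWeight + ∑< n shadowWeight) ∎
    where open ≡-Reasoning

  module _ .{{_ : NonZero n}} (G⊆Cycle : ∀ {i j} → G i j → Cycle n i j) (cover : MycielskiCover) where

    copy-cover : CycleCover (λ k → copyWeight k + shadowWeight k)
    copy-cover i with cover (vV i)
    ... | vU   , ()  , _
    ... | vV j , i~j , 1≤w = j , G⊆Cycle i~j , ≤-trans 1≤w (m≤m+n _ _)
    ... | vS j , i~j , 1≤w = j , G⊆Cycle i~j , ≤-trans 1≤w (m≤n+m _ _)

    shadow-cover : weight vU ≡ 0 → CycleCover copyWeight
    shadow-cover u∉C i with cover (vS i)
    ... | vU   , _   , 1≤w = contradiction (subst (1 ≤_) u∉C 1≤w) λ ()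
    ... | vV j , j~i , 1≤w = j , Cycle-sym (G⊆Cycle j~i) , 1≤w
    ... | vS j , ()  , _

    apex-cover : 1 ≤ ∑< n shadowWeight
    apex-cover with cover vU
    ... | vU   , () , _
    ... | vV j , () , _
    ... | vS j , _  , 1≤w = ≤-trans 1≤w (∑-term-≤ shadowWeight (toℕ<n j))

    cover-bound : γt n + 1 ≤ weight vU + (∑< n copyWeight + ∑< n shadowWeight)
    cover-bound with weight vU in u∈?C
    ... | zero  = +-mono-≤ (cycle-cover-bound copyWeight (shadow-cover u∈?C)) apex-cover
    ... | suc c = begin
      γt n + 1                                         ≡⟨ +-comm (γt n) 1 ⟩
      suc (γt n)                                       ≤⟨ s≤s (cycle-cover-bound _ copy-cover) ⟩
      suc (∑[ k < n ] (copyWeight k + shadowWeight k)) ≡⟨ cong suc (∑-distrib-+ n) ⟩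
      suc (∑< n copyWeight + ∑< n shadowWeight)        ≤⟨ s≤s (m≤n+m _ c) ⟩
      suc c + (∑< n copyWeight + ∑< n shadowWeight)    ∎
      where open ≤-Reasoning

mycielski-ltd-bound : ∀ {n} .{{_ : NonZero n}} (G : Graph n) → (∀ {i j} → G i j → Cycle n i j) →
                      ∀ C → IsLTD (Mycielski G) C → γt n + 1 ≤ ∣ C ∣
mycielski-ltd-bound {n} G G⊆Cycle C (dom , _) = begin
  γt n + 1 ≤⟨ cover-bound G C G⊆Cycle (total-domination⇒cover G C dom) ⟩
  _        ≡⟨ ∣∣≡apex+copies+shadows G C ⟨
  ∣ C ∣    ∎
  where open ≤-Reasoning

corollary3 : (n : ℕ) → 3 ≤ n →
    ((C : Subset (suc (n + n))) → IsLTD (Mycielski (Path n)) C →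
        (n / 2) ∸ (n / 4) + ((n + 3) / 4) + 1 ≤ ∣ C ∣)
    × ((C : Subset (suc (n + n))) → IsLTD (Mycielski (Cycle n)) C →
        (n / 2) ∸ (n / 4) + ((n + 3) / 4) + 1 ≤ ∣ C ∣)
corollary3 n 3≤n = mycielski-ltd-bound (Path n) inj₁ , mycielski-ltd-bound (Cycle n) id
  where
  instance
    n≢0 : NonZero n
    n≢0 = >-nonZero (≤-trans (s≤s z≤n) 3≤n)
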